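{- If $Q$ is a basic sequence that is infinite in limit, then the set of real numbers in $[0,1)$ that are $Q$-ratio normal is dense in $[0,1)$.
   Context: A basic sequence is a sequence $Q=\{q_n\}_{n\ge1}$ of integers with $q_n\ge 2$ for all $n$; it is infinite in limit if $q_n\to\infty$. The $Q$-Cantor series expansion of $x\in[0,1)$ is the unique expansion $x=\sum_{n\ge1}\frac{E_n}{q_1q_2\cdots q_n}$ with $E_n\in\{0,1,\dots,q_n-1\}$ and $E_n\neq q_n-1$ for infinitely many $n$. A block of length $k$ is an ordered $k$-tuple of non-negative integers. For a block $B$ of length $k$, $N_n^Q(B,x)$ is the number of $j\in\{1,\dots,n\}$ with $(E_j,\dots,E_{j+k-1})=B$. $x$ is $Q$-ratio normal of order $k$ if for all blocks $B,B'$ of length $k$, $\lim_{n\to\infty}N_n^Q(B,x)/N_n^Q(B',x)=1$, and $Q$-ratio normal if it is $Q$-ratio normal of order $k$ for every positive integer $k$. -}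

module Defs where

open import Data.Nat using (ℕ; zero; suc; _+_; _*_; _∸_; _≤_; _<_; ∣_-_∣)
open import Data.Nat.Properties using (_≟_)
open import Data.Fin using (toℕ)
open import Data.Vec using (Vec; tabulate)
import Data.Vec.Properties as VecP
open import Data.Product using (Σ; _×_; ∃)
open import Relation.Binary.PropositionalEquality using (_≡_; _≢_)
open import Relation.Nullary using (yes; no)

-- Sequences are 0-indexed: index i here corresponds to index i+1 in the paper.

IsBasic : (ℕ → ℕ) → Set
IsBasic q = ∀ n → 2 ≤ q n

InfiniteInLimit : (ℕ → ℕ) → Set
InfiniteInLimit q = ∀ M → Σ ℕ λ N → ∀ n → N ≤ n → M ≤ q n

-- E is the digit sequence of a Q-Cantor series expansion (of some x ∈ [0,1)):
-- 0 ≤ E n < q n and E n ≠ q n - 1 for infinitely many n.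
IsQExpansion : (ℕ → ℕ) → (ℕ → ℕ) → Set
IsQExpansion q E = (∀ n → E n < q n) × (∀ N → Σ ℕ λ n → N ≤ n × E n ≢ q n ∸ 1)

blockAt : (E : ℕ → ℕ) (k j : ℕ) → Vec ℕ k
blockAt E k j = tabulate (λ i → E (j + toℕ i))

count : (E : ℕ → ℕ) {k : ℕ} → Vec ℕ k → ℕ → ℕ
count E B zero = 0
count E {k} B (suc n) with VecP.≡-dec _≟_ (blockAt E k n) B
... | yes _ = suc (count E B n)
... | no _ = count E B n

-- N_n(B)/N_n(B') → 1, written out with ε = 1/(m+1):
-- eventually |N_n(B) - N_n(B')| · (m+1) < N_n(B')  (which forces N_n(B') > 0).
RatioTendsToOne : (ℕ → ℕ) → (ℕ → ℕ) → Set
RatioTendsToOne f g = ∀ m → Σ ℕ λ N → ∀ n → N ≤ n → ∣ f n - g n ∣ * suc m < g n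

RatioNormalOfOrder : (E : ℕ → ℕ) → ℕ → Set
RatioNormalOfOrder E k = (B B' : Vec ℕ k) → RatioTendsToOne (count E B) (count E B')

RatioNormal : (ℕ → ℕ) → Set
RatioNormal E = ∀ k → 1 ≤ k → RatioNormalOfOrder E k

-- Partial sums of the Cantor series: s_n = num q E n / den q n, where
-- den q n = q_0 ⋯ q_{n-1} and s_n = Σ_{i<n} E_i / (q_0 ⋯ q_i).
den : (ℕ → ℕ) → ℕ → ℕ
den q zero = 1
den q (suc n) = den q n * q n

num : (ℕ → ℕ) → (ℕ → ℕ) → ℕ → ℕ
num q E zero = 0
num q E (suc n) = num q E n * q n + E n

-- x = Σ E_i/(q_0⋯q_i) lies strictly inside the rational interval (c/d, c'/d).
-- x > c/d  iff some partial sum s_n > c/d  (s_n increase to x);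
-- x < c'/d iff some s_n + 1/(q_0⋯q_{n-1}) < c'/d  (these upper bounds decrease to x,
-- and x ≤ s_n + 1/(q_0⋯q_{n-1}) always).
InInterval : (q E : ℕ → ℕ) (d c c' : ℕ) → Set
InInterval q E d c c' =
  (∃ λ n → c * den q n < num q E n * d) ×
  (∃ λ n → suc (num q E n) * d < c' * den q n)

-- A prefix of 2d digits, the mixed-radix representation of a
-- suitable N < q₀⋯q₂d₋₁, pins x strictly inside (c/d, c′/d). After it come segments, each the
-- concatenation of all words of length L over {0,…,s}; in such a segment a block of length
-- k+1 ≤ s occurs between (t+1)(s+1)^t and (t+1)(s+1)^t + (s+1)^L·k times (t = L − k − 1), so all
-- blocks occur almost equally often. The stage s grows so slowly that q n ≥ s + 2 along stage-s
-- segments (the digits are admissible and never equal q n − 1) and that each segment is short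
-- compared with the counts accumulated before it; hence at every position the counts of any
-- two blocks differ by an arbitrarily small fraction.

module Submission where

open import Defs
open import Data.Empty using (⊥-elim)
open import Data.Fin using (toℕ)
open import Data.List using (List; []; _∷_; _++_; length; map; concat; upTo; applyUpTo; cartesianProductWith)
open import Data.List.Extrema.Nat using (max; xs≤max)
open import Data.List.Properties
  using (length-++; length-map; length-upTo; map-++; map-∘; map-upTo; map-cong; map-cong-local; ++-identityʳ; ++-assoc)
open import Data.List.Relation.Unary.All as All using (All; []; _∷_)
open import Data.List.Relation.Unary.All.Properties using (++⁺; map⁺; applyUpTo⁺₁; applyUpTo⁺₂; concat⁺)
open import Data.Nat
open import Data.Nat.DivMod
open import Data.Nat.ListAction using (sum)
open import Data.Nat.ListAction.Properties using (sum-++)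
open import Data.Nat.Properties
open import Algebra.Properties.CommutativeSemigroup +-commutativeSemigroup using (interchange)
open import Algebra.Properties.CommutativeSemigroup *-commutativeSemigroup using (x∙yz≈y∙xz)
open import Data.Nat.Tactic.RingSolver using (solve-∀)
open import Data.Product using (Σ; _×_; _,_; proj₁; proj₂; ∃)
open import Data.Sum using (inj₁; inj₂)
open import Data.Unit using (⊤; tt)
open import Data.Vec using (Vec; toList)
import Data.Vec.Properties as Vec
open import Data.Vec.Relation.Binary.Equality.Cast using (cast-is-id)
open import Function using (_∘_; const; id)
open import Relation.Binary.PropositionalEquality using (_≡_; _≢_; refl; sym; trans; cong; cong₂; subst; subst₂; module ≡-Reasoning)
open import Relation.Nullary using (yes; no)

m≤n+o∧n≤m+o⇒∣m-n∣≤o : ∀ {m n o} → m ≤ n + o → n ≤ m + o → ∣ m - n ∣ ≤ o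
m≤n+o∧n≤m+o⇒∣m-n∣≤o {zero}  {n}     _       n≤o     = n≤o
m≤n+o∧n≤m+o⇒∣m-n∣≤o {suc m} {zero}  m≤o     _       = m≤o
m≤n+o∧n≤m+o⇒∣m-n∣≤o {suc m} {suc n} (s≤s p) (s≤s q) = m≤n+o∧n≤m+o⇒∣m-n∣≤o p q

2+m≤n⇒m≢n∸1 : ∀ {m n} → 2 + m ≤ n → m ≢ n ∸ 1
2+m≤n⇒m≢n∸1 {n = suc n} (s≤s 1+n≤n) refl = <-irrefl refl 1+n≤n

stepwise-≤⇒mono-≤ : ∀ {f : ℕ → ℕ} → (∀ n → f n ≤ f (suc n)) → ∀ {m n} → m ≤ n → f m ≤ f n
stepwise-≤⇒mono-≤ f≤f {n = zero}  z≤n = ≤-refl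
stepwise-≤⇒mono-≤ f≤f {n = suc n} m≤1+n with m≤n⇒m<n∨m≡n m≤1+n
... | inj₂ refl      = ≤-refl
... | inj₁ (s≤s m≤n) = ≤-trans (stepwise-≤⇒mono-≤ f≤f m≤n) (f≤f n)

module StrictlyIncreasing (f : ℕ → ℕ) (f0≡0 : f 0 ≡ 0) (f<f : ∀ n → f n < f (suc n)) where

  mono-≤ : ∀ {m n} → m ≤ n → f m ≤ f n
  mono-≤ = stepwise-≤⇒mono-≤ (<⇒≤ ∘ f<f)

  cancel-< : ∀ {m n} → f m < f n → m < n
  cancel-< {m} {n} fm<fn with m <? n
  ... | yes m<n = m<n
  ... | no  m≮n = ⊥-elim (<⇒≱ fm<fn (mono-≤ (≮⇒≥ m≮n)))

  n≤f : ∀ n → n ≤ f n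
  n≤f zero    = z≤n
  n≤f (suc n) = ≤-trans (s≤s (n≤f n)) (f<f n)

  index : ℕ → ℕ
  index zero = 0
  index (suc n) with f (suc (index n)) ≤? suc n
  ... | yes _ = suc (index n)
  ... | no  _ = index n

  index-spec : ∀ n → f (index n) ≤ n × n < f (suc (index n))
  index-spec zero = ≤-reflexive f0≡0 , subst (_< f 1) f0≡0 (f<f 0)
  index-spec (suc n) with f (suc (index n)) ≤? suc n | index-spec n
  ... | yes fs≤1+n | _ , n<fs = fs≤1+n , <-≤-trans (s≤s (≤-reflexive (≤-antisym n<fs fs≤1+n))) (f<f (suc (index n)))
  ... | no  fs≰1+n | fi≤n , _ = ≤-trans fi≤n (n≤1+n n) , ≰⇒> fs≰1+n

  index-≥ : ∀ {s n} → f s ≤ n → s ≤ index n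
  index-≥ {s} {n} fs≤n = ≤-pred (cancel-< (≤-<-trans fs≤n (proj₂ (index-spec n))))

-- Partial sums

partialSum : (ℕ → ℕ) → ℕ → ℕ
partialSum f zero    = 0
partialSum f (suc n) = partialSum f n + f n

partialSum-cons : ∀ f n → partialSum f (suc n) ≡ f 0 + partialSum (f ∘ suc) n
partialSum-cons f zero    = +-comm 0 (f 0)
partialSum-cons f (suc n) = trans (cong (_+ f (suc n)) (partialSum-cons f n)) (+-assoc (f 0) _ _)

partialSum-cong : ∀ {f g} n → (∀ j → f j ≡ g j) → partialSum f n ≡ partialSum g n
partialSum-cong zero    f≡g = refl
partialSum-cong (suc n) f≡g = cong₂ _+_ (partialSum-cong n f≡g) (f≡g n)

partialSum-+ : ∀ f g n → partialSum (λ j → f j + g j) n ≡ partialSum f n + partialSum g n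
partialSum-+ f g zero    = refl
partialSum-+ f g (suc n) = trans (cong (_+ (f n + g n)) (partialSum-+ f g n))
                                 (interchange (partialSum f n) (partialSum g n) (f n) (g n))

partialSum-mono-≤ : ∀ {f g} n → (∀ j → f j ≤ g j) → partialSum f n ≤ partialSum g n
partialSum-mono-≤ zero    f≤g = z≤n
partialSum-mono-≤ (suc n) f≤g = +-mono-≤ (partialSum-mono-≤ n f≤g) (f≤g n)

partialSum-++ : ∀ f m n → partialSum f (m + n) ≡ partialSum f m + partialSum (λ j → f (m + j)) n
partialSum-++ f m zero    = trans (cong (partialSum f) (+-identityʳ m)) (sym (+-identityʳ _))
partialSum-++ f m (suc n) = begin
  partialSum f (m + suc n)                                         ≡⟨ cong (partialSum f) (+-suc m n) ⟩
  partialSum f (m + n) + f (m + n)                                 ≡⟨ cong (_+ f (m + n)) (partialSum-++ f m n) ⟩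
  partialSum f m + partialSum (λ j → f (m + j)) n + f (m + n)      ≡⟨ +-assoc (partialSum f m) _ _ ⟩
  partialSum f m + partialSum (λ j → f (m + j)) (suc n)            ∎
  where open ≡-Reasoning

*-partialSum-≤ : ∀ {f g} c n → (∀ j → c * f j ≤ g j) → c * partialSum f n ≤ partialSum g n
*-partialSum-≤ c zero    cf≤g = ≤-reflexive (*-zeroʳ c)
*-partialSum-≤ {f} c (suc n) cf≤g =
  ≤-trans (≤-reflexive (*-distribˡ-+ c (partialSum f n) (f n))) (+-mono-≤ (*-partialSum-≤ c n cf≤g) (cf≤g n))

partialSum-positive : ∀ {f} n → (∀ j → 1 ≤ f j) → n ≤ partialSum f n
partialSum-positive zero    f≥1 = z≤n
partialSum-positive (suc n) f≥1 = ≤-trans (≤-reflexive (+-comm 1 n)) (+-mono-≤ (partialSum-positive n f≥1) (f≥1 n))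

partialSum-+k≤ : ∀ (x y : ℕ → ℕ) k J →
  partialSum (λ j → x j + k) J ≤ partialSum y J + partialSum (λ j → ∣ x j - y j ∣ + k) J
partialSum-+k≤ x y k J = ≤-trans
  (partialSum-mono-≤ J (λ j → ≤-trans (+-monoˡ-≤ k (m≤n+∣m-n∣ (x j) (y j))) (≤-reflexive (+-assoc (y j) _ k))))
  (≤-reflexive (partialSum-+ y _ J))

∣-∣≤partialSum : ∀ {a b} (x y : ℕ → ℕ) k J R →
  partialSum x J ≤ a → a ≤ partialSum (λ j → x j + k) J + R →
  partialSum y J ≤ b → b ≤ partialSum (λ j → y j + k) J + R →
  ∣ a - b ∣ ≤ partialSum (λ j → ∣ x j - y j ∣ + k) J + R
∣-∣≤partialSum {a} {b} x y k J R x≤a a≤ y≤b b≤ = m≤n+o∧n≤m+o⇒∣m-n∣≤o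
  (≤-trans a≤ (shift x y b y≤b (≤-reflexive refl)))
  (≤-trans b≤ (shift y x a x≤a (≤-reflexive (partialSum-cong J (λ j → cong (_+ k) (∣-∣-comm (y j) (x j)))))))
  where
  open ≤-Reasoning
  G = partialSum (λ j → ∣ x j - y j ∣ + k) J
  shift : ∀ (u v : ℕ → ℕ) c → partialSum v J ≤ c → partialSum (λ j → ∣ u j - v j ∣ + k) J ≤ G →
          partialSum (λ j → u j + k) J + R ≤ c + (G + R)
  shift u v c v≤c gᵤᵥ≤G = begin
    partialSum (λ j → u j + k) J + R                                    ≤⟨ +-monoˡ-≤ R (partialSum-+k≤ u v k J) ⟩
    partialSum v J + partialSum (λ j → ∣ u j - v j ∣ + k) J + R         ≤⟨ +-monoˡ-≤ R (+-mono-≤ v≤c gᵤᵥ≤G) ⟩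
    c + G + R                                                           ≡⟨ +-assoc c G R ⟩
    c + (G + R)                                                         ∎

partialSum-dominated : ∀ (g y : ℕ → ℕ) T {J₀ J} R →
  (∀ j → J₀ ≤ j → T * g j ≤ y j) → (∀ j → J₀ ≤ j → 1 ≤ y j) →
  J₀ + T * partialSum g J₀ < J → T * R ≤ J ∸ J₀ →
  T * (partialSum g J + R) < 3 * partialSum y J
partialSum-dominated g y T {J₀} {J} R Tg≤y y≥1 J₀+TC<J TR≤r = begin-strict
  T * (partialSum g J + R)    ≡⟨ cong (λ S → T * (S + R)) g-split ⟩
  T * (C + G′ + R)            ≡⟨ trans (*-distribˡ-+ T (C + G′) R) (cong (_+ T * R) (*-distribˡ-+ T C G′)) ⟩
  T * C + T * G′ + T * R      <⟨ +-mono-<-≤ (+-mono-<-≤ TC<r TG′≤Y′) TR≤r ⟩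
  r + Y′ + r                  ≤⟨ +-mono-≤ (+-mono-≤ (≤-trans r≤Y′ Y′≤Y) Y′≤Y) (≤-trans r≤Y′ Y′≤Y) ⟩
  Y + Y + Y                   ≡⟨ trans (+-assoc Y Y Y) (cong (λ z → Y + (Y + z)) (sym (+-identityʳ Y))) ⟩
  3 * Y                       ∎
  where
  open ≤-Reasoning
  r = J ∸ J₀
  J≡J₀+r : J ≡ J₀ + r
  J≡J₀+r = sym (m+[n∸m]≡n (≤-trans (m≤m+n J₀ _) (<⇒≤ J₀+TC<J)))
  C  = partialSum g J₀
  G′ = partialSum (λ j → g (J₀ + j)) r
  Y′ = partialSum (λ j → y (J₀ + j)) r
  Y  = partialSum y J
  g-split : partialSum g J ≡ C + G′
  g-split = trans (cong (partialSum g) J≡J₀+r) (partialSum-++ g J₀ r)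
  Y′≤Y : Y′ ≤ Y
  Y′≤Y = ≤-trans (m≤n+m Y′ (partialSum y J₀)) (≤-reflexive (sym (trans (cong (partialSum y) J≡J₀+r) (partialSum-++ y J₀ r))))
  TC<r : T * C < r
  TC<r = +-cancelˡ-< J₀ _ _ (subst (J₀ + T * C <_) J≡J₀+r J₀+TC<J)
  TG′≤Y′ : T * G′ ≤ Y′
  TG′≤Y′ = *-partialSum-≤ T r (λ j → Tg≤y (J₀ + j) (m≤m+n J₀ j))
  r≤Y′ : r ≤ Y′
  r≤Y′ = partialSum-positive r (λ j → y≥1 (J₀ + j) (m≤m+n J₀ j))

module _ {a b c} {A : Set a} {B : Set b} {C : Set c} (f : A → B → C) where

  length-cartesianProductWith : ∀ xs ys → length (cartesianProductWith f xs ys) ≡ length xs * length ys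
  length-cartesianProductWith []       ys = refl
  length-cartesianProductWith (x ∷ xs) ys = begin
    length (map (f x) ys ++ cartesianProductWith f xs ys)  ≡⟨ length-++ (map (f x) ys) ⟩
    length (map (f x) ys) + length (cartesianProductWith f xs ys)
      ≡⟨ cong₂ _+_ (length-map (f x) ys) (length-cartesianProductWith xs ys) ⟩
    length ys + length xs * length ys ∎
    where open ≡-Reasoning

  All-cartesianProductWith⁺ : ∀ {p q r} {P : A → Set p} {Q : B → Set q} {R : C → Set r} →
    (∀ {x y} → P x → Q y → R (f x y)) →
    ∀ {xs ys} → All P xs → All Q ys → All R (cartesianProductWith f xs ys)
  All-cartesianProductWith⁺ pres []         qys = []
  All-cartesianProductWith⁺ pres (px ∷ pxs) qys =
    ++⁺ (map⁺ (All.map (pres px) qys)) (All-cartesianProductWith⁺ pres pxs qys)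

  sum-map-cartesianProductWith : ∀ (h : C → ℕ) xs ys →
    sum (map h (cartesianProductWith f xs ys)) ≡ sum (map (λ x → sum (map (h ∘ f x) ys)) xs)
  sum-map-cartesianProductWith h []       ys = refl
  sum-map-cartesianProductWith h (x ∷ xs) ys = begin
    sum (map h (map (f x) ys ++ cartesianProductWith f xs ys))
      ≡⟨ cong sum (map-++ h (map (f x) ys) _) ⟩
    sum (map h (map (f x) ys) ++ map h (cartesianProductWith f xs ys))
      ≡⟨ sum-++ (map h (map (f x) ys)) _ ⟩
    sum (map h (map (f x) ys)) + sum (map h (cartesianProductWith f xs ys))
      ≡⟨ cong₂ _+_ (cong sum (sym (map-∘ ys))) (sum-map-cartesianProductWith h xs ys) ⟩
    sum (map (h ∘ f x) ys) + sum (map (λ x → sum (map (h ∘ f x) ys)) xs) ∎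
    where open ≡-Reasoning

module _ {a} {A : Set a} where

  sum-map-+ : ∀ (f g : A → ℕ) xs → sum (map (λ x → f x + g x) xs) ≡ sum (map f xs) + sum (map g xs)
  sum-map-+ f g []       = refl
  sum-map-+ f g (x ∷ xs) = trans (cong (f x + g x +_) (sum-map-+ f g xs)) (interchange (f x) (g x) _ _)

  sum-map-const : ∀ c (xs : List A) → sum (map (const c) xs) ≡ length xs * c
  sum-map-const c []       = refl
  sum-map-const c (x ∷ xs) = cong (c +_) (sum-map-const c xs)

  sum-map-cong : ∀ {f g : A → ℕ} {xs} → All (λ x → f x ≡ g x) xs → sum (map f xs) ≡ sum (map g xs)
  sum-map-cong = cong sum ∘ map-cong-local

  sum-map-zero : ∀ {f : A → ℕ} {xs} → All (λ x → f x ≡ 0) xs → sum (map f xs) ≡ 0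
  sum-map-zero {xs = xs} f≡0 = trans (sum-map-cong f≡0) (trans (sum-map-const 0 xs) (*-zeroʳ (length xs)))

  length-concat : ∀ (xss : List (List A)) → length (concat xss) ≡ sum (map length xss)
  length-concat []         = refl
  length-concat (xs ∷ xss) = trans (length-++ xs) (cong (length xs +_) (length-concat xss))

sum-applyUpTo-zero : ∀ f n → (∀ a → f a ≡ 0) → sum (applyUpTo f n) ≡ 0
sum-applyUpTo-zero f zero    f≡0 = refl
sum-applyUpTo-zero f (suc n) f≡0 = cong₂ _+_ (f≡0 0) (sum-applyUpTo-zero (f ∘ suc) n (f≡0 ∘ suc))

sum-applyUpTo-δ : ∀ f {n b} → b < n → (∀ a → a ≢ b → f a ≡ 0) → sum (applyUpTo f n) ≡ f b
sum-applyUpTo-δ f {suc n} {zero}  _         f≡0 =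
  trans (cong (f 0 +_) (sum-applyUpTo-zero (f ∘ suc) n (λ a → f≡0 (suc a) λ ()))) (+-identityʳ (f 0))
sum-applyUpTo-δ f {suc n} {suc b} (s≤s b<n) f≡0 =
  cong₂ _+_ (f≡0 0 λ ()) (sum-applyUpTo-δ (f ∘ suc) b<n (λ a a≢b → f≡0 (suc a) (a≢b ∘ suc-injective)))

-- Occurrences of a block in a list

prefixIndicator : List ℕ → List ℕ → ℕ
prefixIndicator []      _        = 1
prefixIndicator (_ ∷ _) []       = 0
prefixIndicator (b ∷ B) (x ∷ xs) with b ≟ x
... | yes _ = prefixIndicator B xs
... | no  _ = 0

occurrences : List ℕ → List ℕ → ℕ
occurrences B []       = 0
occurrences B (x ∷ xs) = prefixIndicator B (x ∷ xs) + occurrences B xs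

prefixIndicator≤1 : ∀ B xs → prefixIndicator B xs ≤ 1
prefixIndicator≤1 []      xs       = ≤-refl
prefixIndicator≤1 (b ∷ B) []       = z≤n
prefixIndicator≤1 (b ∷ B) (x ∷ xs) with b ≟ x
... | yes _ = prefixIndicator≤1 B xs
... | no  _ = z≤n

prefixIndicator-refl : ∀ xs → prefixIndicator xs xs ≡ 1
prefixIndicator-refl []       = refl
prefixIndicator-refl (x ∷ xs) with x ≟ x
... | yes _   = prefixIndicator-refl xs
... | no  x≢x = ⊥-elim (x≢x refl)

prefixIndicator-≢ : ∀ B xs → length B ≡ length xs → B ≢ xs → prefixIndicator B xs ≡ 0
prefixIndicator-≢ []      []       _  B≢xs = ⊥-elim (B≢xs refl)
prefixIndicator-≢ (b ∷ B) (x ∷ xs) eq B≢xs with b ≟ x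
... | yes refl = prefixIndicator-≢ B xs (suc-injective eq) (B≢xs ∘ cong (b ∷_))
... | no  _    = refl

prefixIndicator-short : ∀ B xs → length xs < length B → prefixIndicator B xs ≡ 0
prefixIndicator-short (b ∷ B) []       _         = refl
prefixIndicator-short (b ∷ B) (x ∷ xs) (s≤s xs<B) with b ≟ x
... | yes _ = prefixIndicator-short B xs xs<B
... | no  _ = refl

prefixIndicator-++ : ∀ B u v → length B ≤ length u → prefixIndicator B (u ++ v) ≡ prefixIndicator B u
prefixIndicator-++ []      u       v _         = refl
prefixIndicator-++ (b ∷ B) (x ∷ u) v (s≤s B≤u) with b ≟ x
... | yes _ = prefixIndicator-++ B u v B≤u
... | no  _ = refl

prefixIndicator-++-≤ : ∀ B u v → prefixIndicator B u ≤ prefixIndicator B (u ++ v)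
prefixIndicator-++-≤ []      u       v = ≤-refl
prefixIndicator-++-≤ (b ∷ B) []      v = z≤n
prefixIndicator-++-≤ (b ∷ B) (x ∷ u) v with b ≟ x
... | yes _ = prefixIndicator-++-≤ B u v
... | no  _ = ≤-refl

prefixIndicator-∷-≢ : ∀ {a b} B w → a ≢ b → prefixIndicator (b ∷ B) (a ∷ w) ≡ 0
prefixIndicator-∷-≢ {a} {b} B w a≢b with b ≟ a
... | yes b≡a = ⊥-elim (a≢b (sym b≡a))
... | no  _   = refl

prefixIndicator-∷-≡ : ∀ b B w → prefixIndicator (b ∷ B) (b ∷ w) ≡ prefixIndicator B w
prefixIndicator-∷-≡ b B w with b ≟ b
... | yes _   = refl
... | no  b≢b = ⊥-elim (b≢b refl)

occurrences-short : ∀ B xs → length xs < length B → occurrences B xs ≡ 0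
occurrences-short B []       _    = refl
occurrences-short B (x ∷ xs) xs<B =
  cong₂ _+_ (prefixIndicator-short B (x ∷ xs) xs<B) (occurrences-short B xs (<-trans (n<1+n _) xs<B))

occurrences≤length : ∀ B xs → occurrences B xs ≤ length xs
occurrences≤length B []       = z≤n
occurrences≤length B (x ∷ xs) = +-mono-≤ (prefixIndicator≤1 B (x ∷ xs)) (occurrences≤length B xs)

occurrences-++-≥ : ∀ B u v → occurrences B u + occurrences B v ≤ occurrences B (u ++ v)
occurrences-++-≥ B []      v = ≤-refl
occurrences-++-≥ B (x ∷ u) v = begin
  prefixIndicator B (x ∷ u) + occurrences B u + occurrences B v    ≡⟨ +-assoc (prefixIndicator B (x ∷ u)) _ _ ⟩
  prefixIndicator B (x ∷ u) + (occurrences B u + occurrences B v)  ≤⟨ +-mono-≤ (prefixIndicator-++-≤ B (x ∷ u) v) (occurrences-++-≥ B u v) ⟩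
  prefixIndicator B (x ∷ u ++ v) + occurrences B (u ++ v)          ∎
  where open ≤-Reasoning

occurrences-++-≤length : ∀ B u v → occurrences B (u ++ v) ≤ occurrences B u + occurrences B v + length u
occurrences-++-≤length B []      v = m≤m+n _ _
occurrences-++-≤length B (x ∷ u) v = begin
  prefixIndicator B (x ∷ u ++ v) + occurrences B (u ++ v)
    ≤⟨ +-mono-≤ (prefixIndicator≤1 B _) (occurrences-++-≤length B u v) ⟩
  suc (occurrences B u + occurrences B v + length u)
    ≡⟨ sym (+-suc _ (length u)) ⟩
  occurrences B u + occurrences B v + suc (length u)
    ≤⟨ +-monoˡ-≤ (suc (length u)) (+-monoˡ-≤ (occurrences B v) (m≤n+m _ (prefixIndicator B (x ∷ u)))) ⟩
  occurrences B (x ∷ u) + occurrences B v + suc (length u) ∎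
  where open ≤-Reasoning

-- An occurrence straddling u and v starts in one of the last k positions of u.
occurrences-++-≤ : ∀ B {k} u v → length B ≡ suc k →
                   occurrences B (u ++ v) ≤ occurrences B u + occurrences B v + k
occurrences-++-≤ B     []      v _    = m≤m+n _ _
occurrences-++-≤ B {k} (x ∷ u) v ∣B∣≡ with length (x ∷ u) ≤? k
... | yes short = ≤-trans (occurrences-++-≤length B (x ∷ u) v) (+-monoʳ-≤ _ short)
... | no  long  = begin
  prefixIndicator B (x ∷ u ++ v) + occurrences B (u ++ v)
    ≡⟨ cong (_+ occurrences B (u ++ v)) (prefixIndicator-++ B (x ∷ u) v (subst (_≤ length (x ∷ u)) (sym ∣B∣≡) (≰⇒> long))) ⟩
  p + occurrences B (u ++ v)                                ≤⟨ +-monoʳ-≤ p (occurrences-++-≤ B u v ∣B∣≡) ⟩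
  p + (occurrences B u + occurrences B v + k)               ≡⟨ sym (+-assoc p _ k) ⟩
  p + (occurrences B u + occurrences B v) + k               ≡⟨ cong (_+ k) (sym (+-assoc p _ _)) ⟩
  p + occurrences B u + occurrences B v + k                 ∎
  where
  open ≤-Reasoning
  p = prefixIndicator B (x ∷ u)

-- Words and stage strings

words : ℕ → ℕ → List (List ℕ)
words A zero    = [] ∷ []
words A (suc L) = cartesianProductWith _∷_ (upTo A) (words A L)

length-words : ∀ A L → length (words A L) ≡ A ^ L
length-words A zero    = refl
length-words A (suc L) = trans (length-cartesianProductWith _∷_ (upTo A) (words A L))
                               (cong₂ _*_ (length-upTo A) (length-words A L))

words-length : ∀ A L → All (λ w → length w ≡ L) (words A L)
words-length A zero    = refl ∷ []
words-length A (suc L) =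
  All-cartesianProductWith⁺ _∷_ {P = λ _ → ⊤} (λ _ → cong suc) (applyUpTo⁺₂ id A (λ _ → tt)) (words-length A L)

words-letters : ∀ A L → All (All (_< A)) (words A L)
words-letters A zero    = [] ∷ []
words-letters A (suc L) = All-cartesianProductWith⁺ _∷_ _∷_ (applyUpTo⁺₁ id A id) (words-letters A L)

length-concat-words : ∀ A L → length (concat (words A L)) ≡ A ^ L * L
length-concat-words A L = begin
  length (concat (words A L))        ≡⟨ length-concat (words A L) ⟩
  sum (map length (words A L))       ≡⟨ sum-map-cong (words-length A L) ⟩
  sum (map (const L) (words A L))    ≡⟨ sum-map-const L (words A L) ⟩
  length (words A L) * L             ≡⟨ cong (_* L) (length-words A L) ⟩
  A ^ L * L                          ∎
  where open ≡-Reasoning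

sum-prefixIndicator-words : ∀ {A} B t → All (_< A) B →
  sum (map (prefixIndicator B) (words A (length B + t))) ≡ A ^ t
sum-prefixIndicator-words {A} [] t [] =
  trans (sum-map-const 1 (words A t)) (trans (*-identityʳ _) (length-words A t))
sum-prefixIndicator-words {A} (b ∷ B) t (b<A ∷ B<A) = begin
  sum (map (prefixIndicator (b ∷ B)) (cartesianProductWith _∷_ (upTo A) W))
    ≡⟨ sum-map-cartesianProductWith _∷_ _ (upTo A) W ⟩
  sum (map (λ a → sum (map (prefixIndicator (b ∷ B) ∘ (a ∷_)) W)) (upTo A))
    ≡⟨ cong sum (map-upTo _ A) ⟩
  sum (applyUpTo (λ a → sum (map (prefixIndicator (b ∷ B) ∘ (a ∷_)) W)) A)
    ≡⟨ sum-applyUpTo-δ _ b<A (λ a a≢b → sum-map-zero (All.universal (λ w → prefixIndicator-∷-≢ B w a≢b) W)) ⟩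
  sum (map (prefixIndicator (b ∷ B) ∘ (b ∷_)) W)
    ≡⟨ sum-map-cong (All.universal (prefixIndicator-∷-≡ b B) W) ⟩
  sum (map (prefixIndicator B) W)
    ≡⟨ sum-prefixIndicator-words B t B<A ⟩
  A ^ t ∎
  where
  open ≡-Reasoning
  W = words A (length B + t)

sum-occurrences-words-suc : ∀ B A L →
  sum (map (occurrences B) (words A (suc L))) ≡
  sum (map (prefixIndicator B) (words A (suc L))) + A * sum (map (occurrences B) (words A L))
sum-occurrences-words-suc B A L = begin
  sum (map (occurrences B) (cartesianProductWith _∷_ (upTo A) W))
    ≡⟨ sum-map-cartesianProductWith _∷_ _ (upTo A) W ⟩
  sum (map (λ a → sum (map (λ w → prefixIndicator B (a ∷ w) + occurrences B w) W)) (upTo A))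
    ≡⟨ cong sum (map-cong (λ a → sum-map-+ (prefixIndicator B ∘ (a ∷_)) (occurrences B) W) (upTo A)) ⟩
  sum (map (λ a → sum (map (prefixIndicator B ∘ (a ∷_)) W) + S) (upTo A))
    ≡⟨ sum-map-+ (λ a → sum (map (prefixIndicator B ∘ (a ∷_)) W)) (const S) (upTo A) ⟩
  sum (map (λ a → sum (map (prefixIndicator B ∘ (a ∷_)) W)) (upTo A)) + sum (map (const S) (upTo A))
    ≡⟨ cong₂ _+_ (sym (sum-map-cartesianProductWith _∷_ _ (upTo A) W))
                 (trans (sum-map-const S (upTo A)) (cong (_* S) (length-upTo A))) ⟩
  sum (map (prefixIndicator B) (words A (suc L))) + A * S ∎
  where
  open ≡-Reasoning
  W = words A L
  S = sum (map (occurrences B) W)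

sum-occurrences-words : ∀ {A k} B t → length B ≡ suc k → All (_< A) B →
  sum (map (occurrences B) (words A (t + suc k))) ≡ suc t * A ^ t
sum-occurrences-words {A} {k} B zero ∣B∣≡ B<A = begin
  sum (map (occurrences B) (words A (suc k)))
    ≡⟨ sum-occurrences-words-suc B A k ⟩
  sum (map (prefixIndicator B) (words A (suc k))) + A * sum (map (occurrences B) (words A k))
    ≡⟨ cong₂ (λ m n → m + A * n) onePrefix noOccurrence ⟩
  1 + A * 0
    ≡⟨ cong suc (*-zeroʳ A) ⟩
  1 ∎
  where
  open ≡-Reasoning
  onePrefix : sum (map (prefixIndicator B) (words A (suc k))) ≡ 1
  onePrefix = trans (cong (λ L → sum (map (prefixIndicator B) (words A L))) (sym (trans (+-identityʳ _) ∣B∣≡)))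
                    (sum-prefixIndicator-words B 0 B<A)
  noOccurrence : sum (map (occurrences B) (words A k)) ≡ 0
  noOccurrence = sum-map-zero (All.map (λ {w} ∣w∣≡k → occurrences-short B w (subst₂ _<_ (sym ∣w∣≡k) (sym ∣B∣≡) ≤-refl))
                                       (words-length A k))
sum-occurrences-words {A} {k} B (suc t) ∣B∣≡ B<A = begin
  sum (map (occurrences B) (words A (suc (t + suc k))))
    ≡⟨ sum-occurrences-words-suc B A (t + suc k) ⟩
  sum (map (prefixIndicator B) (words A (suc t + suc k))) + A * sum (map (occurrences B) (words A (t + suc k)))
    ≡⟨ cong₂ (λ m n → m + A * n) prefixes (sum-occurrences-words B t ∣B∣≡ B<A) ⟩
  A ^ suc t + A * (suc t * A ^ t)
    ≡⟨ cong (A ^ suc t +_) (x∙yz≈y∙xz A (suc t) (A ^ t)) ⟩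
  A ^ suc t + suc t * A ^ suc t ∎
  where
  open ≡-Reasoning
  prefixes : sum (map (prefixIndicator B) (words A (suc t + suc k))) ≡ A ^ suc t
  prefixes = trans (cong (λ L → sum (map (prefixIndicator B) (words A L)))
                         (sym (trans (cong (_+ suc t) ∣B∣≡) (+-comm (suc k) (suc t)))))
                   (sum-prefixIndicator-words B (suc t) B<A)

sum-occurrences≤occurrences-concat : ∀ B ws → sum (map (occurrences B) ws) ≤ occurrences B (concat ws)
sum-occurrences≤occurrences-concat B []       = z≤n
sum-occurrences≤occurrences-concat B (w ∷ ws) =
  ≤-trans (+-monoʳ-≤ (occurrences B w) (sum-occurrences≤occurrences-concat B ws)) (occurrences-++-≥ B w (concat ws))

occurrences-concat≤ : ∀ B {k} ws → length B ≡ suc k →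
  occurrences B (concat ws) ≤ sum (map (occurrences B) ws) + length ws * k
occurrences-concat≤ B     []       _    = z≤n
occurrences-concat≤ B {k} (w ∷ ws) ∣B∣≡ = begin
  occurrences B (w ++ concat ws)                         ≤⟨ occurrences-++-≤ B w (concat ws) ∣B∣≡ ⟩
  occurrences B w + occurrences B (concat ws) + k        ≤⟨ +-monoˡ-≤ k (+-monoʳ-≤ (occurrences B w) (occurrences-concat≤ B ws ∣B∣≡)) ⟩
  occurrences B w + (S + length ws * k) + k              ≡⟨ cong (_+ k) (sym (+-assoc (occurrences B w) S _)) ⟩
  occurrences B w + S + length ws * k + k                ≡⟨ +-assoc (occurrences B w + S) (length ws * k) k ⟩
  occurrences B w + S + (length ws * k + k)              ≡⟨ cong (occurrences B w + S +_) (+-comm (length ws * k) k) ⟩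
  occurrences B w + S + length (w ∷ ws) * k              ∎
  where
  open ≤-Reasoning
  S = sum (map (occurrences B) ws)

occurrences-concat-words : ∀ {A k} B t → length B ≡ suc k → All (_< A) B →
  suc t * A ^ t ≤ occurrences B (concat (words A (t + suc k))) ×
  occurrences B (concat (words A (t + suc k))) ≤ suc t * A ^ t + A ^ (t + suc k) * k
occurrences-concat-words {A} {k} B t ∣B∣≡ B<A =
  subst (_≤ occurrences B (concat W)) total (sum-occurrences≤occurrences-concat B W) ,
  ≤-trans (occurrences-concat≤ B W ∣B∣≡) (≤-reflexive (cong₂ _+_ total (cong (_* k) (length-words A (t + suc k)))))
  where
  W = words A (t + suc k)
  total = sum-occurrences-words B t ∣B∣≡ B<A

stage-error≤ : ∀ {T k s t} → T ≤ s → k < s → s * s * (suc s ^ s + 1) ≤ t →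
  T * (suc s ^ (t + suc k) * k + k) ≤ suc t * suc s ^ t
stage-error≤ {T} {k} {s} {t} T≤s k<s t≥ = begin
  T * (suc s ^ (t + suc k) * k + k)
    ≡⟨ cong (λ a → T * (a * k + k)) (^-distribˡ-+-* (suc s) t (suc k)) ⟩
  T * (P * Aᵏ * k + k)
    ≤⟨ *-monoʳ-≤ T (+-monoʳ-≤ (P * Aᵏ * k) k≤Pk) ⟩
  T * (P * Aᵏ * k + P * k)
    ≡⟨ regroup T P Aᵏ k ⟩
  T * k * (Aᵏ + 1) * P
    ≤⟨ *-monoˡ-≤ P (*-mono-≤ (*-mono-≤ T≤s (≤-trans (n≤1+n k) k<s)) (+-monoˡ-≤ 1 (^-monoʳ-≤ (suc s) k<s))) ⟩
  s * s * (suc s ^ s + 1) * P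
    ≤⟨ *-monoˡ-≤ P (≤-trans t≥ (n≤1+n t)) ⟩
  suc t * P ∎
  where
  open ≤-Reasoning
  P  = suc s ^ t
  Aᵏ = suc s ^ suc k
  k≤Pk : k ≤ P * k
  k≤Pk = ≤-trans (≤-reflexive (sym (*-identityˡ k))) (*-monoˡ-≤ k (m^n>0 (suc s) t))
  regroup : ∀ T P Aᵏ k → T * (P * Aᵏ * k + P * k) ≡ T * k * (Aᵏ + 1) * P
  regroup = solve-∀

-- Long enough that, for blocks of length k + 1 ≤ s, the boundary error (s+1)^L·k is at most
-- a 1/s fraction of the main term (t+1)(s+1)^t, where t = L − k − 1 (see stage-error≤).
wordLength : ℕ → ℕ
wordLength s = suc (s + s * s * (suc s ^ s + 1))

stageString : ℕ → List ℕ
stageString s = concat (words (suc s) (wordLength s))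

module _ {k s} (k<s : k < s) where

  private
    t = wordLength s ∸ suc k
    c = suc t * suc s ^ t
    t+k≡L : t + suc k ≡ wordLength s
    t+k≡L = m∸n+n≡m (≤-trans k<s (≤-trans (m≤m+n s _) (n≤1+n _)))
    t≥ : s * s * (suc s ^ s + 1) ≤ t
    t≥ = subst (s * s * (suc s ^ s + 1) ≤_) (sym (+-∸-comm (s * s * (suc s ^ s + 1)) (≤-trans (n≤1+n k) k<s)))
               (m≤n+m (s * s * (suc s ^ s + 1)) (s ∸ k))

  stageString-occurrences : ∀ B → length B ≡ suc k → All (_< suc s) B →
    c ≤ occurrences B (stageString s) × occurrences B (stageString s) ≤ c + suc s ^ wordLength s * k
  stageString-occurrences B ∣B∣≡ B<s =
    subst (λ L → c ≤ occurrences B (concat (words (suc s) L)) ×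
                 occurrences B (concat (words (suc s) L)) ≤ c + suc s ^ L * k)
          t+k≡L (occurrences-concat-words B t ∣B∣≡ B<s)

  stageString-contains : ∀ B → length B ≡ suc k → All (_< suc s) B → 1 ≤ occurrences B (stageString s)
  stageString-contains B ∣B∣≡ B<s =
    ≤-trans (*-mono-≤ {1} {suc t} (s≤s z≤n) (m^n>0 (suc s) t)) (proj₁ (stageString-occurrences B ∣B∣≡ B<s))

  stageString-balanced : ∀ {T} B B′ → length B ≡ suc k → length B′ ≡ suc k →
    All (_< suc s) B → All (_< suc s) B′ → T ≤ s →
    T * (∣ occurrences B (stageString s) - occurrences B′ (stageString s) ∣ + k) ≤ occurrences B′ (stageString s)
  stageString-balanced {T} B B′ ∣B∣≡ ∣B′∣≡ B<s B′<s T≤s = begin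
    T * (∣ x - y ∣ + k)   ≤⟨ *-monoʳ-≤ T (+-monoˡ-≤ k ∣x-y∣≤e) ⟩
    T * (e + k)           ≡⟨ cong (λ L → T * (suc s ^ L * k + k)) t+k≡L ⟨
    T * (suc s ^ (t + suc k) * k + k) ≤⟨ stage-error≤ T≤s k<s t≥ ⟩
    c                     ≤⟨ proj₁ (stageString-occurrences B′ ∣B′∣≡ B′<s) ⟩
    y                     ∎
    where
    open ≤-Reasoning
    x = occurrences B (stageString s)
    y = occurrences B′ (stageString s)
    e = suc s ^ wordLength s * k
    ∣x-y∣≤e : ∣ x - y ∣ ≤ e
    ∣x-y∣≤e = m≤n+o∧n≤m+o⇒∣m-n∣≤o
      (≤-trans (proj₂ (stageString-occurrences B ∣B∣≡ B<s)) (+-monoˡ-≤ e (proj₁ (stageString-occurrences B′ ∣B′∣≡ B′<s))))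
      (≤-trans (proj₂ (stageString-occurrences B′ ∣B′∣≡ B′<s)) (+-monoˡ-≤ e (proj₁ (stageString-occurrences B ∣B∣≡ B<s))))

-- Block counts of a sequence

window : (ℕ → ℕ) → ℕ → ℕ → List ℕ
window E p zero    = []
window E p (suc n) = E p ∷ window E (suc p) n

length-window : ∀ E p n → length (window E p n) ≡ n
length-window E p zero    = refl
length-window E p (suc n) = cong suc (length-window E (suc p) n)

window-++ : ∀ E p m n → window E p (m + n) ≡ window E p m ++ window E (p + m) n
window-++ E p zero    n = cong (λ p′ → window E p′ n) (sym (+-identityʳ p))
window-++ E p (suc m) n = cong (E p ∷_) (trans (window-++ E (suc p) m n) (cong (λ p′ → window E (suc p) m ++ window E p′ n) (sym (+-suc p m))))

toList-blockAt : ∀ E k p → toList (blockAt E k p) ≡ window E p k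
toList-blockAt E zero    p = refl
toList-blockAt E (suc k) p = cong₂ _∷_ (cong E (+-identityʳ p))
  (trans (cong toList (Vec.tabulate-cong (λ i → cong E (+-suc p (toℕ i))))) (toList-blockAt E k (suc p)))

count-suc : ∀ E {k} (B : Vec ℕ k) n →
  count E B (suc n) ≡ count E B n + prefixIndicator (toList B) (window E n k)
count-suc E {k} B n with Vec.≡-dec _≟_ (blockAt E k n) B
... | yes refl = begin
  suc (count E B n)
    ≡⟨ +-comm 1 (count E B n) ⟩
  count E B n + 1
    ≡⟨ cong (count E B n +_) (prefixIndicator-refl (window E n k)) ⟨
  count E B n + prefixIndicator (window E n k) (window E n k)
    ≡⟨ cong (λ xs → count E B n + prefixIndicator xs (window E n k)) (toList-blockAt E k n) ⟨
  count E B n + prefixIndicator (toList (blockAt E k n)) (window E n k) ∎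
  where open ≡-Reasoning
... | no  block≢B = sym (trans (cong (count E B n +_) noMatch) (+-identityʳ _))
  where
  noMatch : prefixIndicator (toList B) (window E n k) ≡ 0
  noMatch = prefixIndicator-≢ (toList B) (window E n k)
    (trans (Vec.length-toList B) (sym (length-window E n k)))
    (λ B≡window → block≢B (sym (trans (sym (cast-is-id refl B))
       (Vec.toList-injective refl B (blockAt E k n) (trans B≡window (sym (toList-blockAt E k n)))))))

count≡partialSum : ∀ E {k} (B : Vec ℕ k) n →
  count E B n ≡ partialSum (λ j → prefixIndicator (toList B) (window E j k)) n
count≡partialSum E B zero    = refl
count≡partialSum E {k} B (suc n) =
  trans (count-suc E B n) (cong (_+ prefixIndicator (toList B) (window E n k)) (count≡partialSum E B n))

occurrences-window : ∀ E {k} B → length B ≡ suc k → ∀ p n →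
  occurrences B (window E p (n + k)) ≡ partialSum (λ j → prefixIndicator B (window E (p + j) (suc k))) n
occurrences-window E {k} B ∣B∣≡ p zero =
  occurrences-short B (window E p k) (subst₂ _<_ (sym (length-window E p k)) (sym ∣B∣≡) ≤-refl)
occurrences-window E {k} B ∣B∣≡ p (suc n) = begin
  prefixIndicator B (window E p (suc n + k)) + occurrences B (window E (suc p) (n + k))
    ≡⟨ cong₂ _+_ firstWindow (occurrences-window E B ∣B∣≡ (suc p) n) ⟩
  f 0 + partialSum (λ j → prefixIndicator B (window E (suc p + j) (suc k))) n
    ≡⟨ cong (f 0 +_) (partialSum-cong n (λ j → cong (λ p′ → prefixIndicator B (window E p′ (suc k))) (sym (+-suc p j)))) ⟩
  f 0 + partialSum (f ∘ suc) n
    ≡⟨ partialSum-cons f n ⟨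
  partialSum f (suc n) ∎
  where
  open ≡-Reasoning
  f : ℕ → ℕ
  f j = prefixIndicator B (window E (p + j) (suc k))
  firstWindow : prefixIndicator B (window E p (suc n + k)) ≡ f 0
  firstWindow = begin
    prefixIndicator B (window E p (suc n + k))                          ≡⟨ cong (λ m → prefixIndicator B (window E p (suc m))) (+-comm n k) ⟩
    prefixIndicator B (window E p (suc k + n))                          ≡⟨ cong (prefixIndicator B) (window-++ E p (suc k) n) ⟩
    prefixIndicator B (window E p (suc k) ++ window E (p + suc k) n)    ≡⟨ prefixIndicator-++ B _ _ (≤-reflexive (trans ∣B∣≡ (sym (length-window E p (suc k))))) ⟩
    prefixIndicator B (window E p (suc k))                              ≡⟨ cong (λ p′ → prefixIndicator B (window E p′ (suc k))) (+-identityʳ p) ⟨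
    f 0                                                                 ∎

count≡occurrences-window : ∀ E {k} (B : Vec ℕ (suc k)) n →
  count E B n ≡ occurrences (toList B) (window E 0 (n + k))
count≡occurrences-window E B n =
  trans (count≡partialSum E B n) (sym (occurrences-window E (toList B) (Vec.length-toList B) 0 n))

count-mono-≤ : ∀ E {k} (B : Vec ℕ k) {m n} → m ≤ n → count E B m ≤ count E B n
count-mono-≤ E B = stepwise-≤⇒mono-≤ (λ n → ≤-trans (m≤m+n _ _) (≤-reflexive (sym (count-suc E B n))))

-- Concatenation of segments

-- Junk value 0 beyond the end of the list.
nth : List ℕ → ℕ → ℕ
nth []       _       = 0
nth (x ∷ xs) zero    = x
nth (x ∷ xs) (suc i) = nth xs i

nth-++ˡ : ∀ xs ys {i} → i < length xs → nth (xs ++ ys) i ≡ nth xs i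
nth-++ˡ (x ∷ xs) ys {zero}  _         = refl
nth-++ˡ (x ∷ xs) ys {suc i} (s≤s i<n) = nth-++ˡ xs ys i<n

nth-++ʳ : ∀ xs ys i → nth (xs ++ ys) (length xs + i) ≡ nth ys i
nth-++ʳ []       ys i = refl
nth-++ʳ (x ∷ xs) ys i = nth-++ʳ xs ys i

nth-All : ∀ {p} {P : ℕ → Set p} {xs} → P 0 → All P xs → ∀ i → P (nth xs i)
nth-All P0 []         i       = P0
nth-All P0 (px ∷ pxs) zero    = px
nth-All P0 (px ∷ pxs) (suc i) = nth-All P0 pxs i

nth-window : ∀ E p {n i} → i < n → nth (window E p n) i ≡ E (p + i)
nth-window E p {suc n} {zero}  _         = cong E (sym (+-identityʳ p))
nth-window E p {suc n} {suc i} (s≤s i<n) = trans (nth-window E (suc p) i<n) (cong E (sym (+-suc p i)))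

window-nth : ∀ E xs p → (∀ i → i < length xs → E (p + i) ≡ nth xs i) → window E p (length xs) ≡ xs
window-nth E []       p E≡ = refl
window-nth E (x ∷ xs) p E≡ = cong₂ _∷_ (trans (cong E (sym (+-identityʳ p))) (E≡ 0 (s≤s z≤n)))
  (window-nth E xs (suc p) (λ i i<n → trans (cong E (sym (+-suc p i))) (E≡ (suc i) (s≤s i<n))))

module Concatenation (seg : ℕ → List ℕ) (seg-nonempty : ∀ j → 1 ≤ length (seg j)) where

  initial : ℕ → List ℕ
  initial zero    = []
  initial (suc J) = initial J ++ seg J

  boundary : ℕ → ℕ
  boundary J = length (initial J)

  -- initial (suc p) has more than p entries, since every segment is nonempty.
  digit : ℕ → ℕ
  digit p = nth (initial (suc p)) p

  boundary-suc : ∀ J → boundary (suc J) ≡ boundary J + length (seg J)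
  boundary-suc J = length-++ (initial J)

  boundary-< : ∀ J → boundary J < boundary (suc J)
  boundary-< J = subst (boundary J <_) (sym (boundary-suc J))
    (≤-trans (≤-reflexive (+-comm 1 (boundary J))) (+-monoʳ-≤ (boundary J) (seg-nonempty J)))

  open StrictlyIncreasing boundary refl boundary-<
    using () renaming (cancel-< to boundary-cancel-<; n≤f to ≤boundary; index to segmentOf; index-spec to segmentOf-spec) public

  initial-++ : ∀ J d → ∃ λ r → initial (J + d) ≡ initial J ++ r
  initial-++ J zero    = [] , trans (cong initial (+-identityʳ J)) (sym (++-identityʳ (initial J)))
  initial-++ J (suc d) with initial-++ J d
  ... | r , eq = r ++ seg (J + d) ,
    trans (cong initial (+-suc J d)) (trans (cong (_++ seg (J + d)) eq) (++-assoc (initial J) r _))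

  nth-initial : ∀ J d {p} → p < boundary J → nth (initial (J + d)) p ≡ nth (initial J) p
  nth-initial J d p<b with initial-++ J d
  ... | r , eq = trans (cong (λ xs → nth xs _) eq) (nth-++ˡ (initial J) r p<b)

  digit-initial : ∀ J {p} → p < boundary J → digit p ≡ nth (initial J) p
  digit-initial J {p} p<b = begin
    nth (initial (suc p)) p       ≡⟨ nth-initial (suc p) J (≤-trans (s≤s (≤boundary p)) (boundary-< p)) ⟨
    nth (initial (suc p + J)) p   ≡⟨ cong (λ J′ → nth (initial J′) p) (+-comm (suc p) J) ⟩
    nth (initial (J + suc p)) p   ≡⟨ nth-initial J (suc p) p<b ⟩
    nth (initial J) p             ∎
    where open ≡-Reasoning

  window-initial : ∀ J → window digit 0 (boundary J) ≡ initial J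
  window-initial J = window-nth digit (initial J) 0 (λ i → digit-initial J)

  digit-seg : ∀ J {i} → i < length (seg J) → digit (boundary J + i) ≡ nth (seg J) i
  digit-seg J {i} i<l = trans
    (digit-initial (suc J) (subst (boundary J + i <_) (sym (boundary-suc J)) (+-monoʳ-< (boundary J) i<l)))
    (nth-++ʳ (initial J) (seg J) i)

  module _ {k} (B : Vec ℕ (suc k)) where

    segCount : ℕ → ℕ
    segCount j = occurrences (toList B) (seg j)

    occurrences-initial-≥ : ∀ J → partialSum segCount J ≤ occurrences (toList B) (initial J)
    occurrences-initial-≥ zero    = z≤n
    occurrences-initial-≥ (suc J) = ≤-trans (+-monoˡ-≤ (segCount J) (occurrences-initial-≥ J))
                                            (occurrences-++-≥ (toList B) (initial J) (seg J))

    occurrences-initial-≤ : ∀ J → occurrences (toList B) (initial J) ≤ partialSum (λ j → segCount j + k) J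
    occurrences-initial-≤ zero    = z≤n
    occurrences-initial-≤ (suc J) = begin
      occurrences (toList B) (initial J ++ seg J)                 ≤⟨ occurrences-++-≤ (toList B) (initial J) (seg J) (Vec.length-toList B) ⟩
      occurrences (toList B) (initial J) + segCount J + k         ≤⟨ +-monoˡ-≤ k (+-monoˡ-≤ (segCount J) (occurrences-initial-≤ J)) ⟩
      partialSum (λ j → segCount j + k) J + segCount J + k        ≡⟨ +-assoc (partialSum (λ j → segCount j + k) J) (segCount J) k ⟩
      partialSum (λ j → segCount j + k) (suc J)                   ∎
      where open ≤-Reasoning

    count-boundary : ∀ J → count digit B (boundary J) ≡ occurrences (toList B) (initial J ++ window digit (boundary J) k)
    count-boundary J = trans (count≡occurrences-window digit B (boundary J))
      (cong (occurrences (toList B)) (trans (window-++ digit 0 (boundary J) k) (cong (_++ window digit (boundary J) k) (window-initial J))))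

    count-boundary-≥ : ∀ J → occurrences (toList B) (initial J) ≤ count digit B (boundary J)
    count-boundary-≥ J = subst (occurrences (toList B) (initial J) ≤_) (sym (count-boundary J))
      (≤-trans (m≤m+n _ _) (occurrences-++-≥ (toList B) (initial J) (window digit (boundary J) k)))

    count-boundary-≤ : ∀ J → count digit B (boundary J) ≤ occurrences (toList B) (initial J) + k
    count-boundary-≤ J = subst (_≤ occurrences (toList B) (initial J) + k) (sym (count-boundary J))
      (≤-trans (occurrences-++-≤ (toList B) (initial J) (window digit (boundary J) k) (Vec.length-toList B))
               (≤-reflexive (trans (cong (λ c → occurrences (toList B) (initial J) + c + k) noOccurrence)
                                   (cong (_+ k) (+-identityʳ _)))))
      where
      noOccurrence : occurrences (toList B) (window digit (boundary J) k) ≡ 0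
      noOccurrence = occurrences-short (toList B) (window digit (boundary J) k)
        (subst₂ _<_ (sym (length-window digit (boundary J) k)) (sym (Vec.length-toList B)) ≤-refl)

    count-between : ∀ n → let J = segmentOf n in
      partialSum segCount J ≤ count digit B n ×
      count digit B n ≤ partialSum (λ j → segCount j + k) J + (length (seg J) + 2 * k)
    count-between n =
      ≤-trans (occurrences-initial-≥ J) (≤-trans (count-boundary-≥ J) (count-mono-≤ digit B (proj₁ (segmentOf-spec n)))) ,
      (begin
        count digit B n                                                  ≤⟨ count-mono-≤ digit B (<⇒≤ (proj₂ (segmentOf-spec n))) ⟩
        count digit B (boundary (suc J))                                 ≤⟨ count-boundary-≤ (suc J) ⟩
        occurrences (toList B) (initial (suc J)) + k                     ≤⟨ +-monoˡ-≤ k (occurrences-initial-≤ (suc J)) ⟩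
        partialSum (λ j → segCount j + k) J + (segCount J + k) + k
          ≤⟨ +-monoˡ-≤ k (+-monoʳ-≤ (partialSum _ J) (+-monoˡ-≤ k (occurrences≤length (toList B) (seg J)))) ⟩
        partialSum (λ j → segCount j + k) J + (length (seg J) + k) + k   ≡⟨ regroup (partialSum _ J) (length (seg J)) k ⟩
        partialSum (λ j → segCount j + k) J + (length (seg J) + 2 * k)   ∎)
      where
      open ≤-Reasoning
      J = segmentOf n
      regroup : ∀ S l k → S + (l + k) + k ≡ S + (l + 2 * k)
      regroup = solve-∀

  count-ratio : ∀ {k} (B B′ : Vec ℕ (suc k)) T J₀ J₁ →
    (∀ j → J₀ ≤ j → T * (∣ segCount B j - segCount B′ j ∣ + k) ≤ segCount B′ j) →
    (∀ j → J₀ ≤ j → 1 ≤ segCount B′ j) →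
    (∀ J → J₁ ≤ J → T * (length (seg J) + 2 * k) ≤ J ∸ J₀) →
    J₀ + T * partialSum (λ j → ∣ segCount B j - segCount B′ j ∣ + k) J₀ < J₁ →
    ∀ n → boundary J₁ ≤ n → T * ∣ count digit B n - count digit B′ n ∣ < 3 * count digit B′ n
  count-ratio {k} B B′ T J₀ J₁ Tg≤y y≥1 short early n bJ₁≤n = begin-strict
    T * ∣ a - b ∣              ≤⟨ *-monoʳ-≤ T (∣-∣≤partialSum x y k J R a≥ a≤ b≥ b≤) ⟩
    T * (partialSum g J + R)   <⟨ partialSum-dominated g y T R Tg≤y y≥1 (<-≤-trans early J₁≤J) (short J J₁≤J) ⟩
    3 * partialSum y J         ≤⟨ *-monoʳ-≤ 3 b≥ ⟩
    3 * b                      ∎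
    where
    open ≤-Reasoning
    a = count digit B n
    b = count digit B′ n
    x = segCount B
    y = segCount B′
    g : ℕ → ℕ
    g j = ∣ x j - y j ∣ + k
    J = segmentOf n
    R = length (seg J) + 2 * k
    J₁≤J : J₁ ≤ J
    J₁≤J = ≤-pred (boundary-cancel-< (≤-<-trans bJ₁≤n (proj₂ (segmentOf-spec n))))
    a≥ = proj₁ (count-between B n)
    a≤ = proj₂ (count-between B n)
    b≥ = proj₁ (count-between B′ n)
    b≤ = proj₂ (count-between B′ n)

-- Mixed-radix representation

num-cong : ∀ q {E E′} n → (∀ i → i < n → E i ≡ E′ i) → num q E n ≡ num q E′ n
num-cong q zero    E≡E′ = refl
num-cong q (suc n) E≡E′ = cong₂ _+_ (cong (_* q n) (num-cong q n (λ i i<n → E≡E′ i (m<n⇒m<1+n i<n)))) (E≡E′ n ≤-refl)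

grid-between : ∀ {c c′ d D} .{{_ : NonZero d}} → c < c′ → 2 * d < D →
  ∃ λ N → c * D < N * d × suc N * d < c′ * D
grid-between {c} {c′} {d} {D} c<c′ 2d<D = N , lower , upper
  where
  open ≤-Reasoning
  Q = c * D / d
  N = Q + 1
  cD≡ : c * D ≡ c * D % d + Q * d
  cD≡ = m≡m%n+[m/n]*n (c * D) d
  lower : c * D < N * d
  lower = begin-strict
    c * D               ≡⟨ cD≡ ⟩
    c * D % d + Q * d   <⟨ +-monoˡ-< (Q * d) (m%n<n (c * D) d) ⟩
    d + Q * d           ≡⟨ +-comm d (Q * d) ⟩
    Q * d + d           ≡⟨ cong (Q * d +_) (*-identityˡ d) ⟨
    Q * d + 1 * d       ≡⟨ *-distribʳ-+ d Q 1 ⟨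
    N * d               ∎
  upper : suc N * d < c′ * D
  upper = begin-strict
    suc N * d           ≡⟨ cong (_* d) (+-suc Q 1) ⟨
    (Q + 2) * d         ≡⟨ *-distribʳ-+ d Q 2 ⟩
    Q * d + 2 * d       ≤⟨ +-monoˡ-≤ (2 * d) (≤-trans (m≤n+m (Q * d) (c * D % d)) (≤-reflexive (sym cD≡))) ⟩
    c * D + 2 * d       <⟨ +-monoʳ-< (c * D) 2d<D ⟩
    c * D + D           ≡⟨ +-comm (c * D) D ⟩
    suc c * D           ≤⟨ *-monoˡ-≤ D c<c′ ⟩
    c′ * D              ∎

module MixedRadix (q : ℕ → ℕ) (basic : IsBasic q) where

  instance
    q-nonZero : ∀ {n} → NonZero (q n)
    q-nonZero {n} = >-nonZero (≤-trans (s≤s z≤n) (basic n))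

  -- digits n N i is the i-th digit of N < q₀ ⋯ qₙ₋₁ in the mixed radix q, most significant first.
  digits : ℕ → ℕ → ℕ → ℕ
  digits zero    N i = 0
  digits (suc n) N i with i ≟ n
  ... | yes _ = N % q n
  ... | no  _ = digits n (N / q n) i

  digits-< : ∀ n N i → digits n N i < q i
  digits-< zero    N i = ≤-trans (s≤s z≤n) (basic i)
  digits-< (suc n) N i with i ≟ n
  ... | yes refl = m%n<n N (q n)
  ... | no  _    = digits-< n (N / q n) i

  digits-last : ∀ n N → digits (suc n) N n ≡ N % q n
  digits-last n N with n ≟ n
  ... | yes _   = refl
  ... | no  n≢n = ⊥-elim (n≢n refl)

  digits-init : ∀ n N i → i < n → digits (suc n) N i ≡ digits n (N / q n) i
  digits-init n N i i<n with i ≟ n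
  ... | yes refl = ⊥-elim (<-irrefl refl i<n)
  ... | no  _    = refl

  num-digits : ∀ n N → N < den q n → num q (digits n N) n ≡ N
  num-digits zero    zero    _         = refl
  num-digits zero    (suc N) (s≤s ())
  num-digits (suc n) N N<den = begin
    num q (digits (suc n) N) n * q n + digits (suc n) N n  ≡⟨ cong₂ (λ a b → a * q n + b) (num-cong q n (digits-init n N)) (digits-last n N) ⟩
    num q (digits n (N / q n)) n * q n + N % q n           ≡⟨ cong (λ a → a * q n + N % q n) (num-digits n (N / q n) (m<n*o⇒m/o<n N<den)) ⟩
    N / q n * q n + N % q n                                ≡⟨ +-comm _ (N % q n) ⟩
    N % q n + N / q n * q n                                ≡⟨ m≡m%n+[m/n]*n N (q n) ⟨
    N                                                      ∎
    where open ≡-Reasoning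

  n<den : ∀ n → n < den q n
  n<den zero    = ≤-refl
  n<den (suc n) = begin-strict
    1 + n                   <⟨ +-mono-≤-< (≤-trans (s≤s z≤n) (n<den n)) (n<den n) ⟩
    den q n + den q n       ≡⟨ cong (den q n +_) (+-identityʳ (den q n)) ⟨
    2 * den q n             ≡⟨ *-comm 2 (den q n) ⟩
    den q n * 2             ≤⟨ *-monoʳ-≤ (den q n) (basic n) ⟩
    den q n * q n           ∎
    where open ≤-Reasoning

-- The construction

letters-< : ∀ {n s} (B : Vec ℕ n) → max 0 (toList B) ≤ s → All (_< suc s) (toList B)
letters-< B max≤s = All.map (λ x≤max → s≤s (≤-trans x≤max max≤s)) (xs≤max 0 (toList B))

module Construction (q : ℕ → ℕ) (basic : IsBasic q) (inf : InfiniteInLimit q)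
                    {c c′ d : ℕ} .{{_ : NonZero d}} (c<c′ : c < c′) (c′≤d : c′ ≤ d) where

  open MixedRadix q basic

  n₀ : ℕ
  n₀ = 2 * d

  N₀ : ℕ
  N₀ = proj₁ (grid-between {c} {c′} {d} {den q n₀} c<c′ (n<den n₀))

  N₀-between : c * den q n₀ < N₀ * d × suc N₀ * d < c′ * den q n₀
  N₀-between = proj₂ (grid-between c<c′ (n<den n₀))

  N₀<den : N₀ < den q n₀
  N₀<den = <-trans (n<1+n N₀) (*-cancelʳ-< d (suc N₀) (den q n₀)
    (≤-trans (proj₂ N₀-between) (≤-trans (*-monoˡ-≤ (den q n₀) c′≤d) (≤-reflexive (*-comm d (den q n₀))))))

  -- From threshold s on, q exceeds s + 1, so the letters 0, …, s are digits different from q n − 1.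
  threshold : ℕ → ℕ
  threshold s = proj₁ (inf (s + 2))

  -- Segment j ≥ 1 is the stage string of stage s when stageStart s ≤ j < stageStart (s + 1).
  -- The gap keeps each stage-(s+1) segment short compared with the number of segments since stageStart s.
  stageStart : ℕ → ℕ
  stageStart zero    = 0
  stageStart (suc s) = stageStart s + suc s * (length (stageString (suc s)) + suc s) + threshold (suc s)

  stageStart-gap : ∀ s → suc s * (length (stageString (suc s)) + suc s) ≤ stageStart (suc s) ∸ stageStart s
  stageStart-gap s = begin
    suc s * (length (stageString (suc s)) + suc s)                      ≡⟨ m+n∸m≡n (stageStart s) _ ⟨
    stageStart s + suc s * (length (stageString (suc s)) + suc s) ∸ stageStart s ≤⟨ ∸-monoˡ-≤ (stageStart s) (m≤m+n _ _) ⟩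
    stageStart (suc s) ∸ stageStart s                                   ∎
    where open ≤-Reasoning

  stageStart-< : ∀ s → stageStart s < stageStart (suc s)
  stageStart-< s = <-≤-trans (m<m+n (stageStart s) 0<gap) (m≤m+n _ (threshold (suc s)))
    where
    0<gap : 0 < suc s * (length (stageString (suc s)) + suc s)
    0<gap = ≤-trans (s≤s z≤n) (≤-trans (m≤n+m (suc s) (length (stageString (suc s)))) (m≤m+n _ _))

  open StrictlyIncreasing stageStart refl stageStart-<
    using () renaming (mono-≤ to stageStart-mono-≤; n≤f to ≤stageStart; index to stageOf; index-spec to stageOf-spec; index-≥ to stageOf-≥)

  q-large : ∀ s p → stageStart s ≤ p → s + 2 ≤ q p
  q-large zero    p _   = basic p
  q-large (suc s) p s≤p = proj₂ (inf (suc s + 2)) p (≤-trans (m≤n+m _ _) s≤p)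

  seg : ℕ → List ℕ
  seg zero    = window (digits n₀ N₀) 0 n₀
  seg (suc j) = stageString (stageOf (suc j))

  seg-nonempty : ∀ j → 1 ≤ length (seg j)
  seg-nonempty zero    = subst (1 ≤_) (sym (length-window (digits n₀ N₀) 0 n₀)) (≤-trans (>-nonZero⁻¹ d) (m≤m+n d _))
  seg-nonempty (suc j) = subst (1 ≤_) (sym (length-concat-words (suc s) (wordLength s))) (*-mono-≤ (m^n>0 (suc s) (wordLength s)) (s≤s z≤n))
    where s = stageOf (suc j)

  open Concatenation seg seg-nonempty public

  boundary₁ : boundary 1 ≡ n₀
  boundary₁ = length-window (digits n₀ N₀) 0 n₀

  digit-prefix : ∀ i → i < n₀ → digit i ≡ digits n₀ N₀ i
  digit-prefix i i<n₀ = trans (digit-seg 0 (subst (i <_) (sym boundary₁) i<n₀)) (nth-window (digits n₀ N₀) 0 i<n₀)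

  2+digit≤q : ∀ p → n₀ ≤ p → 2 + digit p ≤ q p
  2+digit≤q p n₀≤p with segmentOf p | segmentOf-spec p
  ... | zero  | _ , p<b₁ = ⊥-elim (<⇒≱ p<b₁ (subst (_≤ p) (sym boundary₁) n₀≤p))
  ... | suc j | bJ≤p , p<bJ+1 = begin
    2 + digit p   ≡⟨ +-comm 2 (digit p) ⟩
    digit p + 2   ≤⟨ +-monoˡ-≤ 2 (≤-pred digit<) ⟩
    s + 2         ≤⟨ q-large s p (≤-trans (proj₁ (stageOf-spec (suc j))) (≤-trans (≤boundary (suc j)) bJ≤p)) ⟩
    q p           ∎
    where
    open ≤-Reasoning
    s = stageOf (suc j)
    i = p ∸ boundary (suc j)
    p≡ : boundary (suc j) + i ≡ p
    p≡ = m+[n∸m]≡n bJ≤p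
    i<l : i < length (seg (suc j))
    i<l = +-cancelˡ-< (boundary (suc j)) i _ (subst₂ _<_ (sym p≡) (boundary-suc (suc j)) p<bJ+1)
    digit< : digit p < suc s
    digit< = subst (_< suc s) (trans (sym (digit-seg (suc j) i<l)) (cong digit p≡))
      (nth-All (s≤s z≤n) (concat⁺ (words-letters (suc s) (wordLength s))) i)

  isQExpansion : IsQExpansion q digit
  isQExpansion = digit<q , λ N → N + n₀ , m≤m+n N n₀ , 2+m≤n⇒m≢n∸1 (2+digit≤q (N + n₀) (m≤n+m n₀ N))
    where
    digit<q : ∀ p → digit p < q p
    digit<q p with p <? n₀
    ... | yes p<n₀ = subst (_< q p) (sym (digit-prefix p p<n₀)) (digits-< n₀ N₀ p)
    ... | no  p≮n₀ = ≤-trans (n≤1+n _) (2+digit≤q p (≮⇒≥ p≮n₀))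

  inInterval : InInterval q digit d c c′
  inInterval = (n₀ , subst (λ N → c * den q n₀ < N * d) (sym num≡N₀) (proj₁ N₀-between)) ,
               (n₀ , subst (λ N → suc N * d < c′ * den q n₀) (sym num≡N₀) (proj₂ N₀-between))
    where
    num≡N₀ : num q digit n₀ ≡ N₀
    num≡N₀ = trans (num-cong q n₀ digit-prefix) (num-digits n₀ N₀ N₀<den)

  late-segments : ∀ {s₀} (P : List ℕ → Set) → 0 < s₀ → (∀ s → s₀ ≤ s → P (stageString s)) →
    ∀ j → stageStart s₀ ≤ j → P (seg j)
  late-segments {s₀} P 0<s₀ P-stage zero    s₀≤0 = ⊥-elim (<⇒≱ (≤-trans 0<s₀ (≤stageStart s₀)) s₀≤0)
  late-segments {s₀} P 0<s₀ P-stage (suc j) s₀≤j = P-stage (stageOf (suc j)) (stageOf-≥ s₀≤j)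

  stage-short : ∀ {s₀ s J T k} → T ≤ s₀ → 2 * k ≤ s₀ → s₀ < s → stageStart s ≤ J →
    T * (length (stageString s) + 2 * k) ≤ J ∸ stageStart s₀
  stage-short {s₀} {suc s} {J} {T} {k} T≤s₀ 2k≤s₀ (s≤s s₀≤s) start≤J = begin
    T * (ℓ + 2 * k)                           ≤⟨ *-mono-≤ (≤-trans T≤s₀ s₀≤1+s) (+-monoʳ-≤ ℓ (≤-trans 2k≤s₀ s₀≤1+s)) ⟩
    suc s * (ℓ + suc s)                       ≤⟨ stageStart-gap s ⟩
    stageStart (suc s) ∸ stageStart s         ≤⟨ ∸-mono start≤J (stageStart-mono-≤ s₀≤s) ⟩
    J ∸ stageStart s₀                         ∎
    where
    open ≤-Reasoning
    ℓ = length (stageString (suc s))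
    s₀≤1+s = ≤-trans s₀≤s (n≤1+n s)

  segment-short : ∀ {s₀ J T k} → T ≤ s₀ → 2 * k ≤ s₀ → stageStart (suc s₀) ≤ J →
    T * (length (seg J) + 2 * k) ≤ J ∸ stageStart s₀
  segment-short {s₀} {zero}  _    _     s₀<0 = ⊥-elim (<⇒≱ (≤-<-trans z≤n (stageStart-< s₀)) s₀<0)
  segment-short {s₀} {suc j} {k = k} T≤s₀ 2k≤s₀ s₀<J =
    stage-short {k = k} T≤s₀ 2k≤s₀ (stageOf-≥ s₀<J) (proj₁ (stageOf-spec (suc j)))

  ratioNormal : RatioNormal digit
  ratioNormal zero    ()
  ratioNormal (suc k) _ B B′ m = boundary J₁ , λ n J₁≤n →
    *-cancelˡ-< 3 _ _ (subst (_< 3 * count digit B′ n) (regroup (∣ count digit B n - count digit B′ n ∣))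
      (count-ratio B B′ T J₀ J₁ balanced contains short early n J₁≤n))
    where
    -- From stage s₀ on, both blocks have legal letters and length, and the stages exceed T.
    T = 3 * suc m
    mB = max 0 (toList B)
    mB′ = max 0 (toList B′)
    s₀ = T + 2 * suc k + mB + mB′
    J₀ = stageStart s₀
    J₁ = stageStart (suc s₀) + suc (J₀ + T * partialSum (λ j → ∣ segCount B j - segCount B′ j ∣ + k) J₀)
    regroup : ∀ x → T * x ≡ 3 * (x * suc m)
    regroup x = trans (*-assoc 3 (suc m) x) (cong (3 *_) (*-comm (suc m) x))
    T≤s₀ : T ≤ s₀
    T≤s₀ = ≤-trans (m≤m+n T (2 * suc k)) (≤-trans (m≤m+n _ mB) (m≤m+n _ mB′))
    2k≤s₀ : 2 * suc k ≤ s₀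
    2k≤s₀ = ≤-trans (m≤n+m (2 * suc k) T) (≤-trans (m≤m+n _ mB) (m≤m+n _ mB′))
    mB≤s₀ : mB ≤ s₀
    mB≤s₀ = ≤-trans (m≤n+m mB (T + 2 * suc k)) (m≤m+n _ mB′)
    mB′≤s₀ : mB′ ≤ s₀
    mB′≤s₀ = m≤n+m mB′ _
    0<s₀ : 0 < s₀
    0<s₀ = ≤-trans (s≤s z≤n) T≤s₀
    balanced : ∀ j → J₀ ≤ j → T * (∣ segCount B j - segCount B′ j ∣ + k) ≤ segCount B′ j
    balanced = late-segments
      (λ xs → T * (∣ occurrences (toList B) xs - occurrences (toList B′) xs ∣ + k) ≤ occurrences (toList B′) xs) 0<s₀
      λ s s₀≤s → stageString-balanced (≤-trans (m≤m+n (suc k) _) (≤-trans 2k≤s₀ s₀≤s)) (toList B) (toList B′)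
        (Vec.length-toList B) (Vec.length-toList B′)
        (letters-< B (≤-trans mB≤s₀ s₀≤s)) (letters-< B′ (≤-trans mB′≤s₀ s₀≤s)) (≤-trans T≤s₀ s₀≤s)
    contains : ∀ j → J₀ ≤ j → 1 ≤ segCount B′ j
    contains = late-segments (λ xs → 1 ≤ occurrences (toList B′) xs) 0<s₀
      λ s s₀≤s → stageString-contains (≤-trans (m≤m+n (suc k) _) (≤-trans 2k≤s₀ s₀≤s)) (toList B′)
        (Vec.length-toList B′) (letters-< B′ (≤-trans mB′≤s₀ s₀≤s))
    short : ∀ J → J₁ ≤ J → T * (length (seg J) + 2 * k) ≤ J ∸ J₀
    short J J₁≤J = segment-short {k = k} T≤s₀ (≤-trans (*-monoʳ-≤ 2 (n≤1+n k)) 2k≤s₀) (≤-trans (m≤m+n _ _) J₁≤J)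
    early : J₀ + T * partialSum (λ j → ∣ segCount B j - segCount B′ j ∣ + k) J₀ < J₁
    early = m≤n+m _ _

mainTheorem5 : (q : ℕ → ℕ) → IsBasic q → InfiniteInLimit q →
    (d c c' : ℕ) → c < c' → c' ≤ d →
    Σ (ℕ → ℕ) λ E → IsQExpansion q E × RatioNormal E × InInterval q E d c c'
mainTheorem5 q basic inf zero    c zero () z≤n
mainTheorem5 q basic inf (suc d) c c′ c<c′ c′≤d = digit , isQExpansion , ratioNormal , inInterval
  where open Construction q basic inf c<c′ c′≤d
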